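{- Let $D$ be a finite digraph and $\alpha=(\alpha_u)_{u\in V(D)}$ a family of mutually disjoint finite digraphs. Suppose $D$ has a semi-Grundy function $f$ and each $\alpha_u$ has a semi-Grundy function $s_u$ ($u\in V(D)$) such that $\max\{s_u(x): x\in V(\alpha_u)\}=\max\{s_v(x): x\in V(\alpha_v)\}$ whenever $\{u,v\}\subseteq f^{ -1}(i)$ for some $i\in\mathbb{N}$. Let $n=\max\{f(x): x\in V(D)\}$ and, for $0\le i\le n$, $m_i=\max\{s_v(x): x\in V(\alpha_v),\ v\in f^{ -1}(i)\}$. Then $\sigma(D,\alpha)$ has a semi-Grundy function $S$ with $\max\{S(x): x\in V(\sigma(D,\alpha))\}=n+\sum_{i=0}^n m_i$.
   Context: All digraphs are finite. For a vertex $x$ of a digraph $D$, $\Gamma^+(x)$ denotes the set of out-neighbours of $x$. A function $s:V(D)\to\mathbb{N}$ (with $\mathbb{N}=\{0,1,2,\dots\}$) is a semi-Grundy function of $D$ if (1) whenever $s(x)=k$, every $y\in\Gamma^+(x)$ satisfies $s(y)\neq k$; and (2) whenever $s(x)=k$, $y\in\Gamma^+(x)$ and $s(y)>k$, there exists $z\in\Gamma^+(y)$ with $s(z)=k$. Standing convention of the paper: every semi-Grundy function takes as its set of values a set of consecutive non-negative integers starting at $0$. Given $D$ and a family $\alpha=(\alpha_v)_{v\in V(D)}$ of mutually disjoint digraphs, the Cartesian product $\sigma(D,\alpha)$ has vertex set $\bigcup_{v}V(\alpha_v)$ and arc set $\bigcup_{v}A(\alpha_v)\cup\{(x,y): x\in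 V(\alpha_u),\ y\in V(\alpha_v),\ (u,v)\in A(D)\}$. -}

module Defs where

open import Data.Nat using (ℕ; zero; suc; _+_; _≤_; _<_)
open import Data.Fin using (Fin)
open import Data.Bool using (Bool; T)
open import Data.Product using (Σ; ∃; ∃-syntax; _×_; _,_)
open import Relation.Binary.PropositionalEquality using (_≡_; _≢_)

record Digraph : Set where
  field
    order : ℕ
    arc   : Fin order → Fin order → Bool

open Digraph public

Vtx : Digraph → Set
Vtx D = Fin (order D)

Arc : (D : Digraph) → Vtx D → Vtx D → Set
Arc D x y = T (arc D x y)

-- Semi-Grundy function on a digraph given by a vertex type and arc relation,
-- including the standing convention: the set of values is {0,…,k} for some k
-- (i.e. every value below an attained value is attained).
record IsSemiGrundy {V : Set} (E : V → V → Set) (s : V → ℕ) : Set where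
  field
    independent : ∀ x y → E x y → s x ≢ s y
    absorbing   : ∀ x y → E x y → s x < s y → ∃[ z ] (E y z × s z ≡ s x)
    consecutive : ∀ x j → j ≤ s x → ∃[ y ] (s y ≡ j)

IsMax : {V : Set} → (V → ℕ) → ℕ → Set
IsMax {V} g m = (∃[ x ] (g x ≡ m)) × (∀ x → g x ≤ m)

σV : (D : Digraph) → (Vtx D → Digraph) → Set
σV D α = Σ (Vtx D) (λ u → Vtx (α u))

data σArc (D : Digraph) (α : Vtx D → Digraph) : σV D α → σV D α → Set where
  inner : ∀ {u x y} → Arc (α u) x y → σArc D α (u , x) (u , y)
  outer : ∀ {u v x y} → Arc D u v → σArc D α (u , x) (v , y)

sumUpTo : (ℕ → ℕ) → ℕ → ℕ
sumUpTo m zero    = m zero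
sumUpTo m (suc n) = sumUpTo m n + m (suc n)

ClassMax : (D : Digraph) (α : Vtx D → Digraph) (f : Vtx D → ℕ)
           (s : (u : Vtx D) → Vtx (α u) → ℕ) (i M : ℕ) → Set
ClassMax D α f s i M =
  (∃[ v ] ∃[ x ] (f v ≡ i × s v x ≡ M)) ×
  (∀ v x → f v ≡ i → s v x ≤ M)

module Submission where

-- The values 0 … n + Σ m i
-- are cut into consecutive blocks, block i being [offset i , offset i + m i]
-- with offset 0 = 0 and offset (i+1) = offset i + m i + 1.  A vertex x of α u
-- gets S (u , x) = offset (f u) + s u x, i.e. the value of s u shifted into the
-- block of the f-class of u.  Arcs inside one α u are handled by s u (the shift
-- is injective); arcs between copies go from block f u to block f v, so either
-- f u = f v is impossible, or f u > f v makes S decrease, or f u < f v and the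
-- absorbing vertex w of D supplies a vertex of α w with the same s-value.
--
-- The theorem follows once the
-- equal-maxima hypothesis is used to show max (s u) = m (f u) for every u.

open import Defs
open import Data.Nat using (ℕ; zero; suc; _+_; _∸_; _≤_; _<_; z≤n; s≤s; _≤?_)
open import Data.Nat.Properties
open import Data.Fin using (Fin)
import Data.Fin as Fin
open import Data.Product using (Σ; ∃-syntax; _×_; _,_; proj₁; proj₂)
open import Data.Sum using (inj₁; inj₂)
open import Data.Empty using (⊥; ⊥-elim)
open import Relation.Binary using (tri<; tri≈; tri>)
open import Relation.Nullary using (yes; no)
open import Relation.Binary.PropositionalEquality
  using (_≡_; refl; sym; trans; cong; cong₂; subst; module ≡-Reasoning)

max-suc : ∀ k (g : Fin (suc k) → ℕ) → Σ ℕ (IsMax g)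
max-suc zero g = g Fin.zero , (Fin.zero , refl) , λ { Fin.zero → ≤-refl }
max-suc (suc k) g with max-suc k (λ i → g (Fin.suc i))
... | a , (w , gw≡a) , bound with g Fin.zero ≤? a
...   | yes g0≤a = a , (Fin.suc w , gw≡a) , λ { Fin.zero → g0≤a ; (Fin.suc i) → bound i }
...   | no g0≰a = g Fin.zero , (Fin.zero , refl) ,
          λ { Fin.zero → ≤-refl ; (Fin.suc i) → ≤-trans (bound i) (<⇒≤ (≰⇒> g0≰a)) }

max-exists : ∀ {k} (g : Fin k → ℕ) → 0 < k → Σ ℕ (IsMax g)
max-exists {suc k} g _ = max-suc k g

attains-below-max : ∀ {V : Set} {E : V → V → Set} {s : V → ℕ} {M j : ℕ} →
  IsSemiGrundy E s → IsMax s M → j ≤ M → ∃[ x ] (s x ≡ j)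
attains-below-max sG ((x , sx≡M) , _) j≤M =
  IsSemiGrundy.consecutive sG x _ (subst (_ ≤_) (sym sx≡M) j≤M)

module Blocks (m : ℕ → ℕ) where

  offset : ℕ → ℕ
  offset zero    = zero
  offset (suc i) = suc (offset i + m i)

  top : ℕ → ℕ
  top i = offset i + m i

  top<offset : ∀ i j → i < j → top i < offset j
  top-mono   : ∀ i j → i ≤ j → top i ≤ top j
  top<offset i (suc j) (s≤s i≤j) = s≤s (top-mono i j i≤j)
  top-mono i j i≤j with m≤n⇒m<n∨m≡n i≤j
  ... | inj₁ i<j  = ≤-trans (<⇒≤ (top<offset i j i<j)) (m≤m+n (offset j) (m j))
  ... | inj₂ refl = ≤-refl

  top≡ : ∀ i → top i ≡ i + sumUpTo m i
  top≡ zero    = refl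
  top≡ (suc i) = cong suc (begin
    top i + m (suc i)                      ≡⟨ cong (_+ m (suc i)) (top≡ i) ⟩
    i + sumUpTo m i + m (suc i)            ≡⟨ +-assoc i (sumUpTo m i) (m (suc i)) ⟩
    i + (sumUpTo m i + m (suc i))          ∎)
    where open ≡-Reasoning

  locate : ∀ k v → v ≤ top k → ∃[ i ] (i ≤ k × offset i ≤ v × v ≤ top i)
  locate zero v v≤top = 0 , z≤n , z≤n , v≤top
  locate (suc k) v v≤top with v ≤? top k
  ... | yes v≤top' with locate k v v≤top'
  ...   | i , i≤k , lo , hi = i , m≤n⇒m≤1+n i≤k , lo , hi
  locate (suc k) v v≤top | no v≰top' = suc k , ≤-refl , ≰⇒> v≰top' , v≤top

module Layered (D : Digraph) (α : Vtx D → Digraph)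
    (f : Vtx D → ℕ) (fG : IsSemiGrundy (Arc D) f)
    (s : (u : Vtx D) → Vtx (α u) → ℕ) (sG : ∀ u → IsSemiGrundy (Arc (α u)) (s u))
    (m : ℕ → ℕ) (s-max : ∀ u → IsMax (s u) (m (f u))) where

  open Blocks m
  module F = IsSemiGrundy fG
  module G u = IsSemiGrundy (sG u)

  S : σV D α → ℕ
  S (u , x) = offset (f u) + s u x

  S-lower : ∀ p → offset (f (proj₁ p)) ≤ S p
  S-lower (u , x) = m≤m+n (offset (f u)) (s u x)

  S-upper : ∀ p → S p ≤ top (f (proj₁ p))
  S-upper (u , x) = +-monoʳ-≤ (offset (f u)) (proj₂ (s-max u) x)

  S-monotone : ∀ p q → f (proj₁ p) < f (proj₁ q) → S p < S q
  S-monotone p q lt = <-≤-trans (≤-<-trans (S-upper p) (top<offset _ _ lt)) (S-lower q)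

  independent : ∀ p q → σArc D α p q → S p ≡ S q → ⊥
  independent (u , x) (.u , y) (inner a) eq =
    G.independent u x y a (+-cancelˡ-≡ (offset (f u)) _ _ eq)
  independent (u , x) (v , y) (outer a) eq with <-cmp (f u) (f v)
  ... | tri< lt _ _ = <⇒≢ (S-monotone (u , x) (v , y) lt) eq
  ... | tri≈ _ e _  = F.independent u v a e
  ... | tri> _ _ gt = <⇒≢ (S-monotone (v , y) (u , x) gt) (sym eq)

  -- For an outer arc upwards, the D-absorber w has f w = f u, hence the same
  -- maximum, so α w contains a vertex with the value s u x.
  absorbing : ∀ p q → σArc D α p q → S p < S q → ∃[ r ] (σArc D α q r × S r ≡ S p)
  absorbing (u , x) (.u , y) (inner a) lt
    with G.absorbing u x y a (+-cancelˡ-< (offset (f u)) _ _ lt)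
  ... | z , a' , sz≡sx = (u , z) , inner a' , cong (offset (f u) +_) sz≡sx
  absorbing (u , x) (v , y) (outer a) lt with <-cmp (f u) (f v)
  ... | tri≈ _ e _  = ⊥-elim (F.independent u v a e)
  ... | tri> _ _ gt = ⊥-elim (<-asym lt (S-monotone (v , y) (u , x) gt))
  ... | tri< flt _ _ with F.absorbing u v a flt
  ...   | w , v→w , fw≡fu
          with attains-below-max (sG w) (s-max w)
                 (subst (λ t → s u x ≤ m t) (sym fw≡fu) (proj₂ (s-max u) x))
  ...     | z , sz≡sx = (w , z) , outer v→w , cong₂ _+_ (cong offset fw≡fu) sz≡sx

  -- A value j below S p lies in some block i ≤ f u; a vertex of class i exists
  -- by consecutiveness of f, and its copy attains j - offset i.
  consecutive : ∀ p j → j ≤ S p → ∃[ r ] (S r ≡ j)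
  consecutive (u , x) j j≤S with locate (f u) j (≤-trans j≤S (S-upper (u , x)))
  ... | i , i≤fu , lo , hi with F.consecutive u i i≤fu
  ...   | v , fv≡i with attains-below-max (sG v) (s-max v) (within-block v fv≡i)
    where
      within-block : ∀ v → f v ≡ i → j ∸ offset i ≤ m (f v)
      within-block v refl = subst (j ∸ offset i ≤_) (m+n∸m≡n (offset i) (m i))
                                  (∸-monoˡ-≤ (offset i) hi)
  ...     | z , sz = (v , z) , trans (cong₂ _+_ (cong offset fv≡i) sz) (m+[n∸m]≡n lo)

  isSemiGrundy : IsSemiGrundy (σArc D α) S
  isSemiGrundy = record
    { independent = independent ; absorbing = absorbing ; consecutive = consecutive }

  isMax : ∀ {n} → IsMax f n → IsMax S (top n)
  isMax ((u , fu≡n) , f≤n) with s-max u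
  ... | (y , sy) , _ = ((u , y) , trans (cong (offset (f u) +_) sy) (cong top fu≡n))
                     , λ p → ≤-trans (S-upper p) (top-mono _ _ (f≤n (proj₁ p)))

-- Under the hypotheses of the theorem, each s u has maximum m (f u): the class
-- f u contains a copy α v attaining m (f u), and all copies in one class share
-- the same maximum.
class-maximum : (D : Digraph) (α : Vtx D → Digraph) → (∀ u → 0 < order (α u)) →
  (f : Vtx D → ℕ) (s : (u : Vtx D) → Vtx (α u) → ℕ) →
  (∀ u v a b → f u ≡ f v → IsMax (s u) a → IsMax (s v) b → a ≡ b) →
  (n : ℕ) → (∀ u → f u ≤ n) →
  (m : ℕ → ℕ) → (∀ i → i ≤ n → ClassMax D α f s i (m i)) →
  ∀ u → IsMax (s u) (m (f u))
class-maximum D α nonempty f s equal-max n f≤n m classMax u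
  with classMax (f u) (f≤n u)
... | (v , x , fv≡fu , sx≡m) , bound with max-exists (s u) (nonempty u)
...   | a , a-max = subst (IsMax (s u)) a≡m a-max
  where
    v-max : IsMax (s v) (m (f u))
    v-max = (x , sx≡m) , λ y → bound v y fv≡fu
    a≡m : a ≡ m (f u)
    a≡m = equal-max u v a (m (f u)) (sym fv≡fu) a-max v-max

theorem7 : (D : Digraph) (α : Vtx D → Digraph) →
    0 < order D → (∀ u → 0 < order (α u)) →
    (f : Vtx D → ℕ) → IsSemiGrundy (Arc D) f →
    (s : (u : Vtx D) → Vtx (α u) → ℕ) → (∀ u → IsSemiGrundy (Arc (α u)) (s u)) →
    (∀ u v a b → f u ≡ f v → IsMax (s u) a → IsMax (s v) b → a ≡ b) →
    (n : ℕ) → IsMax f n →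
    (m : ℕ → ℕ) → (∀ i → i ≤ n → ClassMax D α f s i (m i)) →
    ∃[ S ] (IsSemiGrundy (σArc D α) S × IsMax S (n + sumUpTo m n))
theorem7 D α _ nonempty f fG s sG equal-max n f-max m classMax =
  L.S , L.isSemiGrundy , subst (IsMax L.S) (Blocks.top≡ m n) (L.isMax f-max)
  where
    s-max : ∀ u → IsMax (s u) (m (f u))
    s-max = class-maximum D α nonempty f s equal-max n (proj₂ f-max) m classMax
    module L = Layered D α f fG s sG m s-max
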